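{- Let $\ell\ge4$ be an integer, $f$ a slow function and $G$ the $(f,\ell)$-layered wheel with layers $L_1,L_2,\dots$. Let $P=p_ip_{i+1}p_{i+2}\dots$ and $Q=q_iq_{i+1}q_{i+2}\dots$ be two vertical paths starting in the same layer $L_i$. If $p_i\ne q_i$, then $V(P)\cap V(Q)=\emptyset$.
   Context: A vertical path starting in layer $i$ is an infinite sequence $P=p_ip_{i+1}p_{i+2}\dots$ with $p_j\in L_j$ and $p_jp_{j+1}$ an edge of $G$ for all $j\ge i$ (not necessarily induced). A function $f:\mathbb N\setminus\{0\}\to\mathbb N\setminus\{0\}$ is slow if $f(1)=1,f(2)=2,f(3)=3$ and $f(i)\le f(i+1)\le f(i)+1$ for all $i$. The $(f,\ell)$-layered wheel $G$ is the infinite graph (considered as an undirected simple graph; orientations only descriptive) whose vertex set is partitioned into finite layers $L_1,L_2,\dots$, built inductively. For $v\in L_i$ let $N^\uparrow(v)$ be the set of neighbours of $v$ in $L_1\cup\dots\cup L_{i-1}$ and $N^\uparrow[v]=N^\uparrow(v)\cup\{v\}$. $L_1$ induces a directed cycle of length $\ell$. Given $L_1,\dots,L_i$, for each $v\in L_i$ create a directed path $L(v)=v_1\dots v_{n_v}$ of new vertices: (a) if $|N^\uparrow(v)|<f(i+1)-1$, then $n_v=\ell-2$, $N^\uparrow(v_1)=N^\uparrow[v]$ and $N^\uparrow(v_j)=\emptyset$ for $j\ge2$; (b) if $|N^\uparrow(v)|=f(i+1)-1=:m$, write $N^\uparrow(v)=\{w_1,\dots,w_m\}$; then $n_v=m(\ell-2)$,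 $N^\uparrow(v_{(j-1)(\ell-2)+1})=N^\uparrow[v]\setminus\{w_j\}$ for $j=1,\dots,m$, and all other vertices of $L(v)$ have $N^\uparrow=\emptyset$ (the construction guarantees $|N^\uparrow(v)|\le f(i+1)-1$ always). Specifying $N^\uparrow(u)$ for a new vertex $u$ means $u$ is adjacent exactly to those vertices of earlier layers. $L_{i+1}=\bigcup_{v\in L_i}V(L(v))$ induces the directed cycle obtained from the paths $L(v)$ by adding, for every arc $vv'$ of the cycle $L_i$, the arc $v_{n_v}v'_1$. -}

module Defs where

open import Data.Nat using (ℕ; zero; suc; _+_; _*_; _∸_; _≤_; _<_; _<ᵇ_; _≡ᵇ_)
open import Data.Bool using (Bool; true; false; if_then_else_)
open import Data.List using (List; []; _∷_; length)
open import Data.List.Membership.Propositional using (_∈_)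
open import Data.Maybe using (Maybe; just; nothing)
open import Data.Product using (_×_)
open import Data.Sum using (_⊎_)
open import Data.Empty using (⊥)
open import Relation.Binary.PropositionalEquality using (_≡_)

-- A slow function f : ℕ∖{0} → ℕ∖{0}, represented as f : ℕ → ℕ
-- (the value at 0 is irrelevant); values on positive arguments are positive.
Slow : (ℕ → ℕ) → Set
Slow f = f 1 ≡ 1 × f 2 ≡ 2 × f 3 ≡ 3
       × (∀ i → 1 ≤ i → 1 ≤ f i)
       × (∀ i → 1 ≤ i → f i ≤ f (suc i) × f (suc i) ≤ suc (f i))

-- Vertices are encoded by addresses: a list of naturals, last-created index first.
--   a ∷ []      : the vertex a (a < ℓ) of the cycle L₁ (arcs a → a+1 mod ℓ);
--   k ∷ v       : the vertex v_{k+1} of the path L(v) (0-based index k).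
-- The layer of an address is its length.
Addr : Set
Addr = List ℕ

dropAt : {A : Set} → ℕ → List A → List A
dropAt j [] = []
dropAt zero (x ∷ xs) = xs
dropAt (suc j) (x ∷ xs) = x ∷ dropAt j xs

block : ℕ → ℕ → ℕ → Maybe ℕ
block d zero k = nothing
block d (suc m) k = go 0 (suc m)
  where
  go : ℕ → ℕ → Maybe ℕ
  go j zero = nothing
  go j (suc r) = if k ≡ᵇ (j * d) then just j else go (suc j) r

module Wheel (ℓ : ℕ) (f : ℕ → ℕ) where

  mutual
    -- N↑(v), listed in some order (this order is the enumeration w₁,…,w_m used in case (b))
    up : Addr → List Addr
    up [] = []
    up (a ∷ []) = []
    up (k ∷ (b ∷ v)) = child k (b ∷ v)

    child : ℕ → Addr → List Addr
    child k v with length (up v) <ᵇ (f (suc (length v)) ∸ 1)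
    ... | true  = if k ≡ᵇ 0 then v ∷ up v else []
    ... | false with block (ℓ ∸ 2) (f (suc (length v)) ∸ 1) k
    ...   | just j  = v ∷ dropAt j (up v)                         -- N↑[v] ∖ {w_{j+1}}
    ...   | nothing = []

  -- n_v, the number of vertices of L(v)
  len : Addr → ℕ
  len v = if length (up v) <ᵇ (f (suc (length v)) ∸ 1)
          then ℓ ∸ 2
          else (f (suc (length v)) ∸ 1) * (ℓ ∸ 2)

  -- valid addresses = vertices of G
  Valid : Addr → Set
  Valid [] = ⊥
  Valid (a ∷ []) = a < ℓ
  Valid (k ∷ (b ∷ v)) = Valid (b ∷ v) × k < len (b ∷ v)

  -- successor of a vertex on the directed cycle of its layer
  next : Addr → Addr
  next [] = []
  next (a ∷ []) = (if suc a <ᵇ ℓ then suc a else 0) ∷ []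
  next (k ∷ (b ∷ v)) = if suc k <ᵇ len (b ∷ v) then suc k ∷ (b ∷ v) else 0 ∷ next (b ∷ v)

  InLayer : Addr → ℕ → Set
  InLayer u i = Valid u × length u ≡ i

  Adj : Addr → Addr → Set
  Adj u w = Valid u × Valid w ×
            ((w ∈ up u) ⊎ (u ∈ up w) ⊎ (next u ≡ w) ⊎ (next w ≡ u))

  -- P k = p_{i+k}: a vertical path starting in layer i
  Vertical : ℕ → (ℕ → Addr) → Set
  Vertical i P = ∀ k → InLayer (P k) (i + k) × Adj (P k) (P (suc k))

{-# OPTIONS --safe #-}
-- In G the only neighbour of a vertex v_j ∈ L(v) lying in the layer just above it is its
-- parent v: every other upward neighbour of v_j belongs to N↑(v), hence to an even earlier
-- layer, and the cycle arcs stay inside a layer. So along a vertical path each vertex is a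
-- child of its predecessor, i.e. p_{i+j} is a descendant of p_i at depth j (as addresses:
-- p_i is the suffix of p_{i+j} left after dropping j entries). A common vertex
-- of P and Q therefore sits at the same depth below p_i and below q_i, forcing p_i = q_i.
-- Neither ℓ ≥ 4 nor the slowness of f plays a role.
module Submission where

open import Defs
open import Data.Nat using (ℕ; _≤_; _<_; zero; suc; _+_; _∸_; _<ᵇ_; _≡ᵇ_)
open import Data.Nat.Properties using (n<1+n; m<n⇒m<1+n; <-asym; <⇒≢; 1+n≢n; suc-injective; +-suc; +-cancelˡ-≡)
open import Data.List using (List; []; _∷_; length; drop)
open import Data.List.Membership.Propositional using (_∈_)
open import Data.List.Relation.Unary.Any using (here; there)
open import Data.Bool using (true; false)
open import Data.Maybe using (just; nothing)
open import Data.Product using (_,_; proj₁; proj₂; ∃)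
open import Data.Sum using (_⊎_; inj₁; inj₂)
open import Relation.Nullary using (contradiction)
open import Relation.Binary.PropositionalEquality using (_≢_; _≡_; refl; sym; trans; cong; subst; module ≡-Reasoning)

∈-dropAt⁻ : {A : Set} (j : ℕ) (xs : List A) {x : A} → x ∈ dropAt j xs → x ∈ xs
∈-dropAt⁻ j       []       ()
∈-dropAt⁻ zero    (y ∷ xs) x∈         = there x∈
∈-dropAt⁻ (suc j) (y ∷ xs) (here x≡y) = here x≡y
∈-dropAt⁻ (suc j) (y ∷ xs) (there x∈) = there (∈-dropAt⁻ j xs x∈)

module WheelProperties (ℓ : ℕ) (f : ℕ → ℕ) where
  open Wheel ℓ f

  ∈-child⁻ : ∀ k v {x} → x ∈ child k v → x ≡ v ⊎ x ∈ up v
  ∈-child⁻ k v x∈ with length (up v) <ᵇ (f (suc (length v)) ∸ 1)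
  ∈-child⁻ k v x∈ | true with k ≡ᵇ 0
  ∈-child⁻ k v (here x≡v) | true | true = inj₁ x≡v
  ∈-child⁻ k v (there x∈) | true | true = inj₂ x∈
  ∈-child⁻ k v () | true | false
  ∈-child⁻ k v x∈ | false with block (ℓ ∸ 2) (f (suc (length v)) ∸ 1) k
  ∈-child⁻ k v (here x≡v) | false | just j = inj₁ x≡v
  ∈-child⁻ k v (there x∈) | false | just j = inj₂ (∈-dropAt⁻ j (up v) x∈)
  ∈-child⁻ k v () | false | nothing

  ∈-up-∷⁻ : ∀ k v {x} → x ∈ up (k ∷ v) → x ≡ v ⊎ x ∈ up v
  ∈-up-∷⁻ k []      ()
  ∈-up-∷⁻ k (b ∷ v) x∈ = ∈-child⁻ k (b ∷ v) x∈

  ∈-up⇒length< : ∀ u {x} → x ∈ up u → length x < length u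
  ∈-up⇒length< []      ()
  ∈-up⇒length< (k ∷ v) x∈ with ∈-up-∷⁻ k v x∈
  ... | inj₁ refl = n<1+n (length v)
  ... | inj₂ x∈up = m<n⇒m<1+n (∈-up⇒length< v x∈up)

  length-next : ∀ u → length (next u) ≡ length u
  length-next []          = refl
  length-next (a ∷ [])    = refl
  -- The recursive call is taken outside the with-abstraction so that the termination checker sees it.
  length-next (k ∷ b ∷ v) with suc k <ᵇ len (b ∷ v) | length-next (b ∷ v)
  ... | true  | _       = refl
  ... | false | |next|≡ = cong suc |next|≡

  Adj-downward⇒child : ∀ {u w} → Adj u w → length w ≡ suc (length u) → ∃ λ k → w ≡ k ∷ u
  Adj-downward⇒child {u} {w} (_ , _ , inj₁ w∈up) |w|≡ =
    contradiction (subst (_< length u) |w|≡ (∈-up⇒length< u w∈up)) (<-asym (n<1+n (length u)))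
  Adj-downward⇒child {u} {k ∷ v} (_ , _ , inj₂ (inj₁ u∈up)) |w|≡ with ∈-up-∷⁻ k v u∈up
  ... | inj₁ refl = k , refl
  ... | inj₂ u∈up′ = contradiction (sym (suc-injective |w|≡)) (<⇒≢ (∈-up⇒length< v u∈up′))
  Adj-downward⇒child {u} {w} (_ , _ , inj₂ (inj₂ (inj₁ next-u≡w))) |w|≡ =
    contradiction (trans (sym |w|≡) (trans (cong length (sym next-u≡w)) (length-next u))) 1+n≢n
  Adj-downward⇒child {u} {w} (_ , _ , inj₂ (inj₂ (inj₂ next-w≡u))) |w|≡ =
    contradiction (trans (sym |w|≡) (trans (sym (length-next w)) (cong length next-w≡u))) 1+n≢n

  Vertical-length : ∀ {i P} → Vertical i P → ∀ j → length (P j) ≡ i + j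
  Vertical-length V j = proj₂ (proj₁ (V j))

  Vertical-drop : ∀ {i P} → Vertical i P → ∀ j → drop j (P j) ≡ P 0
  Vertical-drop V zero = refl
  Vertical-drop {i} {P} V (suc j) with Adj-downward⇒child (proj₂ (V j)) |P[1+j]|≡
    where
    |P[1+j]|≡ : length (P (suc j)) ≡ suc (length (P j))
    |P[1+j]|≡ = trans (Vertical-length V (suc j)) (trans (+-suc i j) (cong suc (sym (Vertical-length V j))))
  ... | k , P[1+j]≡ rewrite P[1+j]≡ = Vertical-drop V j

mainTheorem8 : (ℓ : ℕ) → 4 ≤ ℓ → (f : ℕ → ℕ) → Slow f →
    (i : ℕ) → 1 ≤ i → (P Q : ℕ → Addr) →
    Wheel.Vertical ℓ f i P → Wheel.Vertical ℓ f i Q →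
    P 0 ≢ Q 0 → (j k : ℕ) → P j ≢ Q k
mainTheorem8 ℓ _ f _ i _ P Q VP VQ P₀≢Q₀ j k Pj≡Qk = P₀≢Q₀ (P₀≡Q₀ j≡k)
  where
  open WheelProperties ℓ f
  open ≡-Reasoning

  j≡k : j ≡ k
  j≡k = +-cancelˡ-≡ i j k (begin
    i + j           ≡⟨ sym (Vertical-length VP j) ⟩
    length (P j)    ≡⟨ cong length Pj≡Qk ⟩
    length (Q k)    ≡⟨ Vertical-length VQ k ⟩
    i + k           ∎)

  P₀≡Q₀ : j ≡ k → P 0 ≡ Q 0
  P₀≡Q₀ refl = begin
    P 0             ≡⟨ sym (Vertical-drop VP j) ⟩
    drop j (P j)    ≡⟨ cong (drop j) Pj≡Qk ⟩
    drop j (Q j)    ≡⟨ Vertical-drop VQ j ⟩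
    Q 0             ∎
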